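{- Let $\lambda\vdash k$, let $0\leq h\leq\ell(\lambda)$, and let $0\leq\alpha<k-h$. Then \[f_{h,\alpha}^{\lambda}=\sum_{v\in\operatorname{IC}(\lambda)}f_{h,\alpha}^{\lambda-v}.\]
   Context: For a partition $\lambda=(\lambda_1,\ldots,\lambda_\ell)\vdash k$ with length $\ell(\lambda)=\ell$, its diagram has boxes $(i,j)$, $1\le i\le\ell$, $1\le j\le\lambda_i$. An inner corner is a box $(i,j)\in\lambda$ with $(i+1,j)\notin\lambda$ and $(i,j+1)\notin\lambda$; $\operatorname{IC}(\lambda)$ is their set, and for $v=(i,j)\in\operatorname{IC}(\lambda)$, $\lambda-v\vdash k-1$ is obtained by decreasing $\lambda_i$ by $1$. $\operatorname{SYT}(\mu)$ is the set of standard Young tableaux of shape $\mu$ (bijective fillings of the boxes with $1,\ldots,|\mu|$ increasing along rows and down columns). For $T\in\operatorname{SYT}(\mu)$, $R_T(m)$ is the row containing $m$. For $\mu\vdash m$, $0\le h\le m$ and $0\le\alpha\le m-h$, $\operatorname{SYT}_{h,\alpha}(\mu)$ is the set of $T\in\operatorname{SYT}(\mu)$ with $R_T(i+1+\alpha)>R_T(i+\alpha)$ for all $1\le i<h$, and $f^{\mu}_{h,\alpha}=|\operatorname{SYT}_{h,\alpha}(\mu)|$. -}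

module Defs where

open import Data.Nat using (ℕ; zero; suc; _+_; _∸_; _≤_; _<_; _≥_; _≟_; _≤?_; _<?_)
open import Data.List using (List; []; _∷_; length; map; concat; concatMap; filter; upTo)
import Data.List.Properties as LP
open import Data.Nat.ListAction using (sum)
open import Data.List.Relation.Unary.All using (All; all?)
open import Data.List.Relation.Unary.Any using (any?)
open import Data.List.Relation.Unary.Linked using (Linked; linked?)
open import Data.Product using (_×_; _,_)
open import Data.Unit using (⊤; tt)
open import Data.Empty using (⊥)
open import Relation.Nullary using (Dec; yes; no; ¬_)
open import Relation.Nullary.Decidable using (_×-dec_; ¬?)
open import Relation.Binary.PropositionalEquality using (_≡_)

range : ℕ → ℕ → List ℕ
range a b = map (a +_) (upTo (b ∸ a))

occ : ℕ → List ℕ → ℕ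
occ x xs = length (filter (x ≟_) xs)

IsPartition : List ℕ → Set
IsPartition la = Linked _≥_ la × All (1 ≤_) la

_⊢_ : List ℕ → ℕ → Set
la ⊢ k = IsPartition la × sum la ≡ k

-- part la i = λ_{i+1} (0-based row index), 0 beyond the last row
part : List ℕ → ℕ → ℕ
part []       _       = 0
part (x ∷ xs) zero    = x
part (x ∷ xs) (suc i) = part xs i

-- Boxes are (row , column), both 0-based here (the paper's (i+1, j+1)).
Box : Set
Box = ℕ × ℕ

_∈D_ : Box → List ℕ → Set
(i , j) ∈D la = j < part la i

_∈D?_ : (v : Box) (la : List ℕ) → Dec (v ∈D la)
(i , j) ∈D? la = j <? part la i

boxes : List ℕ → List Box
boxes la = concatMap (λ i → map (i ,_) (upTo (part la i))) (upTo (length la))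

InnerCorner : List ℕ → Box → Set
InnerCorner la (i , j) = ((i , j) ∈D la) × ¬ ((suc i , j) ∈D la) × ¬ ((i , suc j) ∈D la)

innerCorner? : (la : List ℕ) (v : Box) → Dec (InnerCorner la v)
innerCorner? la (i , j) = ((i , j) ∈D? la) ×-dec (¬? ((suc i , j) ∈D? la) ×-dec ¬? ((i , suc j) ∈D? la))

-- IC(λ), as a duplicate-free list
IC : List ℕ → List Box
IC la = filter (innerCorner? la) (boxes la)

decAt : List ℕ → ℕ → List ℕ
decAt []             _       = []
decAt (zero ∷ xs)    zero    = zero ∷ xs
decAt (suc zero ∷ xs) zero   = xs
decAt (suc (suc n) ∷ xs) zero = suc n ∷ xs
decAt (x ∷ xs)       (suc i) = x ∷ decAt xs i

_-box_ : List ℕ → Box → List ℕ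
la -box (i , j) = decAt la i

-- Tableaux.  A filling of a shape is given row by row: a list of rows,
-- each row the list of its entries from left to right.

Filling : Set
Filling = List (List ℕ)

ColLess : List ℕ → List ℕ → Set
ColLess _        []       = ⊤
ColLess []       (_ ∷ _)  = ⊥
ColLess (x ∷ xs) (y ∷ ys) = (x < y) × ColLess xs ys

colLess? : (r r' : List ℕ) → Dec (ColLess r r')
colLess? _        []       = yes tt
colLess? []       (_ ∷ _)  = no (λ ())
colLess? (x ∷ xs) (y ∷ ys) = (x <? y) ×-dec colLess? xs ys

IsSYT : List ℕ → Filling → Set
IsSYT μ T =
  (map length T ≡ μ)
  × All (λ x → (1 ≤ x) × (x ≤ sum μ)) (concat T)
  × All (λ x → occ x (concat T) ≡ 1) (range 1 (suc (sum μ)))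
  × All (Linked _<_) T
  × Linked ColLess T

isSYT? : (μ : List ℕ) (T : Filling) → Dec (IsSYT μ T)
isSYT? μ T =
  LP.≡-dec _≟_ (map length T) μ
  ×-dec all? (λ x → (1 ≤? x) ×-dec (x ≤? sum μ)) (concat T)
  ×-dec all? (λ x → occ x (concat T) ≟ 1) (range 1 (suc (sum μ)))
  ×-dec all? (linked? _<?_) T
  ×-dec linked? colLess? T

-- R_T(m): the (0-based) index of the row of T containing m
-- (only meaningful when m occurs in T)
rowOf : Filling → ℕ → ℕ
rowOf []      m = 0
rowOf (r ∷ T) m with any? (m ≟_) r
... | yes _ = 0
... | no  _ = suc (rowOf T m)

IsSYTₕₐ : List ℕ → ℕ → ℕ → Filling → Set
IsSYTₕₐ μ h α T =
  IsSYT μ T × All (λ i → rowOf T (i + α) < rowOf T (suc i + α)) (range 1 h)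

isSYTₕₐ? : (μ : List ℕ) (h α : ℕ) (T : Filling) → Dec (IsSYTₕₐ μ h α T)
isSYTₕₐ? μ h α T =
  isSYT? μ T ×-dec all? (λ i → rowOf T (i + α) <? rowOf T (suc i + α)) (range 1 h)

-- Counting.  Candidate fillings: every filling of shape μ with entries in
-- a given alphabet, each exactly once (no duplicates in this list).

words : ℕ → List ℕ → List (List ℕ)
words zero    A = [] ∷ []
words (suc r) A = concatMap (λ a → map (a ∷_) (words r A)) A

fillings : List ℕ → List ℕ → List Filling
fillings []      A = [] ∷ []
fillings (r ∷ μ) A = concatMap (λ w → map (w ∷_) (fillings μ A)) (words r A)

f : List ℕ → ℕ → ℕ → ℕ
f μ h α = length (filter (isSYTₕₐ? μ h α) (fillings μ (range 1 (suc (sum μ)))))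

-- Removing the largest entry k from a standard Young tableau of shape λ ⊢ k leaves a standard
-- Young tableau of shape λ - v, where v is the inner corner that contained k; conversely k may be
-- appended at the end of any row ending in an inner corner.  The defining condition of
-- SYT_{h,α} only involves the rows of the entries 1+α, …, h+α, all smaller than k when α < k - h,
-- so this bijection restricts to SYT_{h,α}(λ) ≅ ⊔_{v ∈ IC(λ)} SYT_{h,α}(λ - v).
module Submission where

open import Defs
open import Data.Nat using (ℕ; zero; suc; _+_; _∸_; _≤_; _<_; _≥_; _≟_; z≤n; s≤s; s≤s⁻¹)
open import Data.Nat.Properties
open import Data.Nat.ListAction using (sum)
open import Data.List using (List; []; _∷_; [_]; _++_; length; map; concat; concatMap; filter; upTo)
import Data.List.Properties as LP
open import Data.List.Relation.Unary.All as All using (All; []; _∷_)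
import Data.List.Relation.Unary.All.Properties as AllP
open import Data.List.Relation.Unary.Any as Any using (here; there; any?)
open import Data.List.Relation.Unary.AllPairs using ([]; _∷_)
open import Data.List.Relation.Unary.Linked as Linked using (Linked; []; [-]; _∷_)
open import Data.List.Relation.Unary.Unique.Propositional using (Unique)
import Data.List.Relation.Unary.Unique.Propositional.Properties as Unique
open import Data.List.Membership.Propositional using (_∈_; _∉_; find; lose)
open import Data.List.Membership.Propositional.Properties
open import Data.List.Membership.Propositional.Properties.WithK using (unique∧set⇒bag)
open import Data.List.Relation.Binary.BagAndSetEquality using (∼bag⇒↭)
open import Data.List.Relation.Binary.Permutation.Propositional using (_↭_; ↭-sym; ↭-trans; ↭-refl)
open import Data.List.Relation.Binary.Permutation.Propositional.Properties
  using (shift; ++⁺ˡ; filter-↭; ↭-length; All-resp-↭)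
open import Data.Product using (∃; ∃₂; _×_; _,_; proj₁; proj₂)
open import Data.Sum using (inj₁; inj₂)
open import Data.Unit using (tt)
open import Function using (_∘_)
open import Function.Bundles using (mk⇔)
open import Relation.Nullary using (yes; no; contradiction)
open import Relation.Binary.PropositionalEquality hiding ([_])

module _ {A B : Set} where

  length-concatMap : (F : A → List B) (xs : List A) →
                     length (concatMap F xs) ≡ sum (map (length ∘ F) xs)
  length-concatMap F []       = refl
  length-concatMap F (x ∷ xs) =
    trans (LP.length-++ (F x)) (cong (length (F x) +_) (length-concatMap F xs))

  unique-map⁺ : (g : A → B) {xs : List A} →
                (∀ {x y} → x ∈ xs → y ∈ xs → g x ≡ g y → x ≡ y) →
                Unique xs → Unique (map g xs)
  unique-map⁺ g {[]}     injective []           = []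
  unique-map⁺ g {x ∷ xs} injective (x∉xs ∷ uxs) =
    AllP.map⁺ (All.tabulate λ y∈xs gx≡gy → All.lookup x∉xs y∈xs (injective (here refl) (there y∈xs) gx≡gy))
    ∷ unique-map⁺ g (λ x∈ y∈ → injective (there x∈) (there y∈)) uxs

  unique-concatMap⁺ : (F : A → List B) {xs : List A} → Unique xs →
                      (∀ {x} → x ∈ xs → Unique (F x)) →
                      (∀ {x y z} → x ∈ xs → y ∈ xs → z ∈ F x → z ∈ F y → x ≡ y) →
                      Unique (concatMap F xs)
  unique-concatMap⁺ F {[]}     []           uF disjoint = []
  unique-concatMap⁺ F {x ∷ xs} (x∉xs ∷ uxs) uF disjoint =
    Unique.++⁺ (uF (here refl))
      (unique-concatMap⁺ F uxs (uF ∘ there) (λ x∈ y∈ → disjoint (there x∈) (there y∈)))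
      λ (z∈Fx , z∈rest) →
        let y , y∈xs , z∈Fy = find (∈-concatMap⁻ F {xs = xs} z∈rest)
        in All.lookup x∉xs y∈xs (disjoint (here refl) (there y∈xs) z∈Fx z∈Fy)

unique∧sameElements⇒length≡ : {A : Set} {xs ys : List A} → Unique xs → Unique ys →
                               (∀ {x} → x ∈ xs → x ∈ ys) → (∀ {x} → x ∈ ys → x ∈ xs) →
                               length xs ≡ length ys
unique∧sameElements⇒length≡ uxs uys to from = ↭-length (∼bag⇒↭ (unique∧set⇒bag uxs uys (mk⇔ to from)))

m<n∸o⇒o+m<n : ∀ {m n o} → m < n ∸ o → o + m < n
m<n∸o⇒o+m<n {m} {n} {o} m<n∸o = subst (o + m <_) (m+[n∸m]≡n o≤n) (+-monoʳ-< o m<n∸o)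
  where
  o≤n : o ≤ n
  o≤n = <⇒≤ (m∸n≢0⇒n<m λ n∸o≡0 → n≮0 (subst (m <_) n∸o≡0 m<n∸o))

∈-range⁺ : ∀ {a b y} → a ≤ y → y < b → y ∈ range a b
∈-range⁺ {a} {b} a≤y y<b =
  subst (_∈ range a b) (m+[n∸m]≡n a≤y) (∈-map⁺ (a +_) (∈-upTo⁺ (∸-monoˡ-< y<b a≤y)))

∈-range⁻ : ∀ {a b y} → y ∈ range a b → a ≤ y × y < b
∈-range⁻ {a} y∈ with ∈-map⁻ (a +_) y∈
... | z , z∈ , refl = m≤m+n a z , m<n∸o⇒o+m<n (∈-upTo⁻ z∈)

unique-range : ∀ a b → Unique (range a b)
unique-range a b = Unique.map⁺ (+-cancelˡ-≡ a _ _) (Unique.upTo⁺ (b ∸ a))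

All-range⁻ : ∀ {P : ℕ → Set} {a b} → All P (range a b) → ∀ {y} → a ≤ y → y < b → P y
All-range⁻ all a≤y y<b = All.lookup all (∈-range⁺ a≤y y<b)

All-range⁺ : ∀ {P : ℕ → Set} {a b} → (∀ {y} → a ≤ y → y < b → P y) → All P (range a b)
All-range⁺ p = All.tabulate λ y∈ → let a≤y , y<b = ∈-range⁻ y∈ in p a≤y y<b

occ-here : ∀ y xs → occ y (y ∷ xs) ≡ suc (occ y xs)
occ-here y xs = cong length (LP.filter-accept (y ≟_) refl)

occ-there : ∀ {y x} xs → y ≢ x → occ y (x ∷ xs) ≡ occ y xs
occ-there {y} xs y≢x = cong length (LP.filter-reject (y ≟_) y≢x)

occ-↭ : ∀ y {xs ys} → xs ↭ ys → occ y xs ≡ occ y ys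
occ-↭ y xs↭ys = ↭-length (filter-↭ (y ≟_) xs↭ys)

∉⇒occ≡0 : ∀ {y xs} → y ∉ xs → occ y xs ≡ 0
∉⇒occ≡0 {y} y∉xs =
  cong length (LP.filter-none (y ≟_) (All.tabulate λ x∈ y≡x → y∉xs (subst (_∈ _) (sym y≡x) x∈)))

occ≡0⇒∉ : ∀ {y xs} → occ y xs ≡ 0 → y ∉ xs
occ≡0⇒∉ {y} occ≡0 y∈xs = n≮0 (subst (0 <_) occ≡0 (∈-length (∈-filter⁺ (y ≟_) y∈xs refl)))

occ≥1⇒∈ : ∀ {y xs} → 1 ≤ occ y xs → y ∈ xs
occ≥1⇒∈ {y} {xs} 1≤occ with filter (y ≟_) xs in eq
... | z ∷ _ with ∈-filter⁻ (y ≟_) {xs = xs} (subst (z ∈_) (sym eq) (here refl))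
...   | z∈xs , refl = z∈xs

max∉ : ∀ {x xs} → All (_< x) xs → x ∉ xs
max∉ all x∈xs = <-irrefl refl (All.lookup all x∈xs)

EntriesOneTo : ℕ → List ℕ → Set
EntriesOneTo n xs = All (λ x → 1 ≤ x × x ≤ n) xs × All (λ x → occ x xs ≡ 1) (range 1 (suc n))

EntriesOneTo-resp-↭ : ∀ {n xs ys} → xs ↭ ys → EntriesOneTo n xs → EntriesOneTo n ys
EntriesOneTo-resp-↭ {xs = xs} xs↭ys (bounded , once) =
  All-resp-↭ xs↭ys bounded , All.map (λ {x} occ≡1 → trans (sym (occ-↭ x xs↭ys)) occ≡1) once

entriesOneTo-≤ : ∀ {n xs} → EntriesOneTo n xs → All (_≤ n) xs
entriesOneTo-≤ (bounded , _) = All.map proj₂ bounded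

entriesOneTo-∈ : ∀ {n xs y} → EntriesOneTo n xs → 1 ≤ y → y ≤ n → y ∈ xs
entriesOneTo-∈ (_ , once) 1≤y y≤n = occ≥1⇒∈ (≤-reflexive (sym (All-range⁻ once 1≤y (s≤s y≤n))))

entriesOneTo-∷⁺ : ∀ {n xs} → EntriesOneTo n xs → EntriesOneTo (suc n) (suc n ∷ xs)
entriesOneTo-∷⁺ {n} {xs} entries@(bounded , once) =
  (s≤s z≤n , ≤-refl) ∷ All.map (λ (1≤x , x≤n) → 1≤x , m≤n⇒m≤1+n x≤n) bounded ,
  All-range⁺ occ≡1
  where
  occ≡1 : ∀ {y} → 1 ≤ y → y < suc (suc n) → occ y (suc n ∷ xs) ≡ 1
  occ≡1 {y} 1≤y y<2+n with y ≟ suc n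
  ... | yes refl = trans (occ-here y xs) (cong suc (∉⇒occ≡0 (max∉ (All.map s≤s (entriesOneTo-≤ entries)))))
  ... | no y≢1+n = trans (occ-there xs y≢1+n) (All-range⁻ once 1≤y (≤∧≢⇒< (s≤s⁻¹ y<2+n) y≢1+n))

entriesOneTo-∷⁻ : ∀ {n xs} → EntriesOneTo (suc n) (suc n ∷ xs) → EntriesOneTo n xs
entriesOneTo-∷⁻ {n} {xs} (_ ∷ bounded , once) =
  All.tabulate (λ x∈xs → let 1≤x , x≤1+n = All.lookup bounded x∈xs in
                 1≤x , s≤s⁻¹ (≤∧≢⇒< x≤1+n λ x≡1+n → 1+n∉xs (subst (_∈ xs) x≡1+n x∈xs))) ,
  All-range⁺ λ 1≤y y≤n → trans (sym (occ-there xs (<⇒≢ y≤n))) (All-range⁻ once 1≤y (m≤n⇒m≤1+n y≤n))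
  where
  1+n∉xs : suc n ∉ xs
  1+n∉xs = occ≡0⇒∉ (suc-injective (trans (sym (occ-here (suc n) xs)) (All-range⁻ once (s≤s z≤n) ≤-refl)))

∈-words⁺ : ∀ r A w → length w ≡ r → All (_∈ A) w → w ∈ words r A
∈-words⁺ zero    A []      refl []            = here refl
∈-words⁺ (suc r) A (a ∷ w) len  (a∈A ∷ w⊆A) =
  ∈-concatMap⁺ (λ b → map (b ∷_) (words r A))
    (Any.map (λ { refl → ∈-map⁺ (a ∷_) (∈-words⁺ r A w (suc-injective len) w⊆A) }) a∈A)

∈-fillings⁺ : ∀ μ A T → map length T ≡ μ → All (All (_∈ A)) T → T ∈ fillings μ A
∈-fillings⁺ []      A []      refl []            = here refl
∈-fillings⁺ (r ∷ μ) A (w ∷ T) shape (w⊆A ∷ T⊆A) =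
  ∈-concatMap⁺ (λ u → map (u ∷_) (fillings μ A))
    (Any.map (λ { refl → ∈-map⁺ (w ∷_) (∈-fillings⁺ μ A T (LP.∷-injectiveʳ shape) T⊆A) })
      (∈-words⁺ r A w (LP.∷-injectiveˡ shape) w⊆A))

module _ {B : Set} where

  unique-prefixed : ∀ {a} {ws : List (List B)} → Unique ws → Unique (map (a ∷_) ws)
  unique-prefixed = Unique.map⁺ LP.∷-injectiveʳ

  prefixed-disjoint : ∀ {a b} {vs ws : List (List B)} {u} →
                      u ∈ map (a ∷_) vs → u ∈ map (b ∷_) ws → a ≡ b
  prefixed-disjoint u∈ u∈′ with ∈-map⁻ _ u∈ | ∈-map⁻ _ u∈′
  ... | _ , _ , refl | _ , _ , refl = refl

unique-words : ∀ r {A} → Unique A → Unique (words r A)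
unique-words zero    uA = [] ∷ []
unique-words (suc r) uA =
  unique-concatMap⁺ _ uA (λ _ → unique-prefixed (unique-words r uA)) (λ _ _ → prefixed-disjoint)

unique-fillings : ∀ μ {A} → Unique A → Unique (fillings μ A)
unique-fillings []      uA = [] ∷ []
unique-fillings (r ∷ μ) uA =
  unique-concatMap⁺ _ (unique-words r uA) (λ _ → unique-prefixed (unique-fillings μ uA))
    (λ _ _ → prefixed-disjoint)

part-antitone : ∀ {la} → Linked _≥_ la → ∀ i → part la (suc i) ≤ part la i
part-antitone []               i       = z≤n
part-antitone [-]              i       = z≤n
part-antitone (la₀≥la₁ ∷ _)    zero    = la₀≥la₁
part-antitone (_ ∷ decreasing) (suc i) = part-antitone decreasing i

part>0⇒<length : ∀ la i → 1 ≤ part la i → i < length la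
part>0⇒<length (_ ∷ la) zero    _       = s≤s z≤n
part>0⇒<length (_ ∷ la) (suc i) 1≤part = s≤s (part>0⇒<length la i 1≤part)

∈-boxes⁺ : ∀ la {i j} → j < part la i → (i , j) ∈ boxes la
∈-boxes⁺ la {i} j<part = ∈-concatMap⁺ (λ i → map (i ,_) (upTo (part la i)))
  (Any.map (λ { refl → ∈-map⁺ (i ,_) (∈-upTo⁺ j<part) })
    (∈-upTo⁺ (part>0⇒<length la i (≤-trans (s≤s z≤n) j<part))))

unique-boxes : ∀ la → Unique (boxes la)
unique-boxes la =
  unique-concatMap⁺ _ (Unique.upTo⁺ (length la))
    (λ _ → Unique.map⁺ (cong proj₂) (Unique.upTo⁺ _)) (λ _ _ → sameRow)
  where
  sameRow : ∀ {i i′ v} {js js′ : List ℕ} → v ∈ map (i ,_) js → v ∈ map (i′ ,_) js′ → i ≡ i′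
  sameRow v∈ v∈′ with ∈-map⁻ _ v∈ | ∈-map⁻ _ v∈′
  ... | _ , _ , refl | _ , _ , refl = refl

∈-IC⁺ : ∀ la {v} → InnerCorner la v → v ∈ IC la
∈-IC⁺ la corner = ∈-filter⁺ (innerCorner? la) (∈-boxes⁺ la (proj₁ corner)) corner

∈-IC⁻ : ∀ la {v} → v ∈ IC la → InnerCorner la v
∈-IC⁻ la v∈ = proj₂ (∈-filter⁻ (innerCorner? la) {xs = boxes la} v∈)

unique-IC : ∀ la → Unique (IC la)
unique-IC la = Unique.filter⁺ (innerCorner? la) (unique-boxes la)

innerCorner⇒longer : ∀ la {i j} → InnerCorner la (i , j) → part la (suc i) < part la i
innerCorner⇒longer _ (j<λi , ¬j<λi+1 , _) = ≤-<-trans (≮⇒≥ ¬j<λi+1) j<λi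

innerCorner⇒lastColumn : ∀ la {i j} → InnerCorner la (i , j) → suc j ≡ part la i
innerCorner⇒lastColumn _ (j<λi , _ , ¬1+j<λi) = ≤-antisym j<λi (≮⇒≥ ¬1+j<λi)

longer⇒innerCorner : ∀ la {i} → part la (suc i) < part la i → InnerCorner la (i , part la i ∸ 1)
longer⇒innerCorner la {i} λi+1<λi with part la i
... | suc λi = n<1+n λi , ≤⇒≯ (s≤s⁻¹ λi+1<λi) , <-irrefl refl

decAt-suc : ∀ a xs i → decAt (a ∷ xs) (suc i) ≡ a ∷ decAt xs i
decAt-suc zero          xs i = refl
decAt-suc (suc zero)    xs i = refl
decAt-suc (suc (suc n)) xs i = refl

length-decAt : ∀ la i → i < length la → i ≤ length (decAt la i)
length-decAt (a ∷ xs) zero    _       = z≤n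
length-decAt (a ∷ xs) (suc i) (s≤s i<len) rewrite decAt-suc a xs i = s≤s (length-decAt xs i i<len)

sum-decAt : ∀ la i → 1 ≤ part la i → suc (sum (decAt la i)) ≡ sum la
sum-decAt (suc zero    ∷ xs) zero    _ = refl
sum-decAt (suc (suc n) ∷ xs) zero    _ = refl
sum-decAt (a ∷ xs)           (suc i) 1≤part rewrite decAt-suc a xs i =
  trans (sym (+-suc a _)) (cong (a +_) (sum-decAt xs i 1≤part))

part-decAt-same : ∀ la i → part la (suc i) < part la i → part (decAt la i) i ≡ part la i ∸ 1
part-decAt-same (suc zero    ∷ xs) zero    λ₁<1 = n<1⇒n≡0 λ₁<1
part-decAt-same (suc (suc n) ∷ xs) zero    _    = refl
part-decAt-same (a ∷ xs)           (suc i) λi+1<λi rewrite decAt-suc a xs i = part-decAt-same xs i λi+1<λi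

part-decAt-above : ∀ la i → part (decAt la (suc i)) i ≡ part la i
part-decAt-above []       i       = refl
part-decAt-above (a ∷ xs) zero    rewrite decAt-suc a xs 0       = refl
part-decAt-above (a ∷ xs) (suc i) rewrite decAt-suc a xs (suc i) = part-decAt-above xs i

-- For i = length T this starts a new bottom row.
snocRow : Filling → ℕ → ℕ → Filling
snocRow []      zero    x = [ x ] ∷ []
snocRow []      (suc i) x = []
snocRow (r ∷ T) zero    x = (r ++ [ x ]) ∷ T
snocRow (r ∷ T) (suc i) x = r ∷ snocRow T i x

rowAt : Filling → ℕ → List ℕ
rowAt []      _       = []
rowAt (r ∷ T) zero    = r
rowAt (r ∷ T) (suc i) = rowAt T i

NonemptyRows : Filling → Set
NonemptyRows = All (λ r → 1 ≤ length r)

length-snoc : ∀ (r : List ℕ) x → length (r ++ [ x ]) ≡ suc (length r)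
length-snoc r x = trans (LP.length-++ r) (+-comm (length r) 1)

snocRow-↭ : ∀ T i x → i ≤ length T → concat (snocRow T i x) ↭ x ∷ concat T
snocRow-↭ []      zero    x _ = ↭-refl
snocRow-↭ (r ∷ T) zero    x _ =
  subst (_↭ x ∷ r ++ concat T) (sym (LP.++-assoc r [ x ] (concat T))) (shift x r (concat T))
snocRow-↭ (r ∷ T) (suc i) x (s≤s i≤len) = ↭-trans (++⁺ˡ r (snocRow-↭ T i x i≤len)) (shift x r (concat T))

snocRow-injective : ∀ T T′ i x → length T ≡ length T′ → snocRow T i x ≡ snocRow T′ i x → T ≡ T′
snocRow-injective []      []        i       x _   _ = refl
snocRow-injective (r ∷ T) (r′ ∷ T′) zero    x _   eq =
  cong₂ _∷_ (LP.∷ʳ-injectiveˡ r r′ (LP.∷-injectiveˡ eq)) (LP.∷-injectiveʳ eq)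
snocRow-injective (r ∷ T) (r′ ∷ T′) (suc i) x len eq =
  cong₂ _∷_ (LP.∷-injectiveˡ eq) (snocRow-injective T T′ i x (suc-injective len) (LP.∷-injectiveʳ eq))

rowAt-snocRow-same : ∀ T i x → i ≤ length T → rowAt (snocRow T i x) i ≡ rowAt T i ++ [ x ]
rowAt-snocRow-same []      zero    x _           = refl
rowAt-snocRow-same (r ∷ T) zero    x _           = refl
rowAt-snocRow-same (r ∷ T) (suc i) x (s≤s i≤len) = rowAt-snocRow-same T i x i≤len

rowAt-snocRow-below : ∀ T i x → rowAt (snocRow T i x) (suc i) ≡ rowAt T (suc i)
rowAt-snocRow-below []      zero    x = refl
rowAt-snocRow-below []      (suc i) x = refl
rowAt-snocRow-below (r ∷ T) zero    x = refl
rowAt-snocRow-below (r ∷ T) (suc i) x = rowAt-snocRow-below T i x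

rowOf-snocRow-self : ∀ T i x → x ∉ concat T → i ≤ length T → rowOf (snocRow T i x) x ≡ i
rowOf-snocRow-self []      zero    x _ _ with any? (x ≟_) [ x ]
... | yes _ = refl
... | no x∉ = contradiction (here refl) x∉
rowOf-snocRow-self (r ∷ T) zero    x _ _ with any? (x ≟_) (r ++ [ x ])
... | yes _ = refl
... | no x∉ = contradiction (∈-++⁺ʳ r (here refl)) x∉
rowOf-snocRow-self (r ∷ T) (suc i) x x∉ (s≤s i≤len) with any? (x ≟_) r
... | yes x∈r = contradiction (∈-++⁺ˡ x∈r) x∉
... | no  _   = cong suc (rowOf-snocRow-self T i x (x∉ ∘ ∈-++⁺ʳ r) i≤len)

rowOf-snocRow-other : ∀ T i x {y} → y ≢ x → y ∈ concat T → rowOf (snocRow T i x) y ≡ rowOf T y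
rowOf-snocRow-other (r ∷ T) zero x {y} y≢x y∈ with any? (y ≟_) (r ++ [ x ]) | any? (y ≟_) r
... | yes _   | yes _   = refl
... | no _    | no _    = refl
... | no y∉   | yes y∈r = contradiction (∈-++⁺ˡ y∈r) y∉
... | yes y∈′ | no y∉r with ∈-++⁻ r y∈′
...   | inj₁ y∈r        = contradiction y∈r y∉r
...   | inj₂ (here y≡x) = contradiction y≡x y≢x
rowOf-snocRow-other (r ∷ T) (suc i) x {y} y≢x y∈ with any? (y ≟_) r
... | yes _  = refl
... | no y∉r with ∈-++⁻ r y∈
...   | inj₁ y∈r = contradiction y∈r y∉r
...   | inj₂ y∈T = cong suc (rowOf-snocRow-other T i x y≢x y∈T)

rowLength : ∀ {T μ} → map length T ≡ μ → ∀ i → length (rowAt T i) ≡ part μ i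
rowLength {[]}    refl i       = refl
rowLength {r ∷ T} refl zero    = refl
rowLength {r ∷ T} refl (suc i) = rowLength {T} refl i

All-rowAt : ∀ {P : ℕ → Set} T i → All (All P) T → All P (rowAt T i)
All-rowAt []      i       []           = []
All-rowAt (r ∷ T) zero    (Pr ∷ _)     = Pr
All-rowAt (r ∷ T) (suc i) (_ ∷ PT)     = All-rowAt T i PT

ColLess-rowAt : ∀ {T} → Linked ColLess T → ∀ i → ColLess (rowAt T i) (rowAt T (suc i))
ColLess-rowAt []          i       = tt
ColLess-rowAt [-]         zero    = tt
ColLess-rowAt [-]         (suc i) = tt
ColLess-rowAt (c ∷ _)     zero    = c
ColLess-rowAt (_ ∷ cols)  (suc i) = ColLess-rowAt cols i

ColLess⇒length≥ : ∀ r r′ → ColLess r r′ → length r′ ≤ length r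
ColLess⇒length≥ r       []       _       = z≤n
ColLess⇒length≥ (x ∷ r) (y ∷ r′) (_ , c) = s≤s (ColLess⇒length≥ r r′ c)

ColLess-++ʳ : ∀ r s r′ → ColLess r r′ → ColLess (r ++ s) r′
ColLess-++ʳ r       s []       _             = tt
ColLess-++ʳ (x ∷ r) s (y ∷ r′) (x<y , c)     = x<y , ColLess-++ʳ r s r′ c

ColLess-++⁻ʳ : ∀ r r′ s → ColLess r (r′ ++ s) → ColLess r r′
ColLess-++⁻ʳ r       []       s _         = tt
ColLess-++⁻ʳ (x ∷ r) (y ∷ r′) s (x<y , c) = x<y , ColLess-++⁻ʳ r r′ s c

ColLess-snoc : ∀ r r′ x → ColLess r r′ → length r′ < length r → All (_< x) r → ColLess r (r′ ++ [ x ])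
ColLess-snoc (a ∷ r) []       x _         _               (a<x ∷ _)  = a<x , tt
ColLess-snoc (a ∷ r) (b ∷ r′) x (a<b , c) (s≤s len<)      (_ ∷ r<x) = a<b , ColLess-snoc r r′ x c len< r<x

ColLess-snoc⁻ : ∀ r x r′ → ColLess (r ++ [ x ]) r′ → All (_≤ x) r′ → ColLess r r′
ColLess-snoc⁻ r       x []       _         _           = tt
ColLess-snoc⁻ []      x (y ∷ r′) (x<y , _) (y≤x ∷ _)   = contradiction (<-≤-trans x<y y≤x) (<-irrefl refl)
ColLess-snoc⁻ (a ∷ r) x (y ∷ r′) (a<y , c) (_ ∷ r′≤x) = a<y , ColLess-snoc⁻ r x r′ c r′≤x

Linked-snoc : ∀ r x → Linked _<_ r → All (_< x) r → Linked _<_ (r ++ [ x ])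
Linked-snoc []          x _              _           = [-]
Linked-snoc (a ∷ [])    x _              (a<x ∷ _)   = a<x ∷ [-]
Linked-snoc (a ∷ b ∷ r) x (a<b ∷ linked) (_ ∷ r<x)   = a<b ∷ Linked-snoc (b ∷ r) x linked r<x

Linked-++⁻ˡ : ∀ r s → Linked _<_ (r ++ s) → Linked _<_ r
Linked-++⁻ˡ []          s _              = []
Linked-++⁻ˡ (a ∷ [])    s _              = [-]
Linked-++⁻ˡ (a ∷ b ∷ r) s (a<b ∷ linked) = a<b ∷ Linked-++⁻ˡ (b ∷ r) s linked

rows-snocRow⁺ : ∀ T i x → All (Linked _<_) T → All (_< x) (rowAt T i) → All (Linked _<_) (snocRow T i x)
rows-snocRow⁺ []      zero    x _             _ = [-] ∷ []
rows-snocRow⁺ []      (suc i) x _             _ = []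
rows-snocRow⁺ (r ∷ T) zero    x (lr ∷ rows)   r<x = Linked-snoc r x lr r<x ∷ rows
rows-snocRow⁺ (r ∷ T) (suc i) x (lr ∷ rows)   T<x = lr ∷ rows-snocRow⁺ T i x rows T<x

rows-snocRow⁻ : ∀ T i x → All (Linked _<_) (snocRow T i x) → All (Linked _<_) T
rows-snocRow⁻ []      i       x _           = []
rows-snocRow⁻ (r ∷ T) zero    x (lr ∷ rows) = Linked-++⁻ˡ r [ x ] lr ∷ rows
rows-snocRow⁻ (r ∷ T) (suc i) x (lr ∷ rows) = lr ∷ rows-snocRow⁻ T i x rows

columns-snocRow⁺ : ∀ T i x → Linked ColLess T → All (All (_< x)) T →
                   (∀ {i′} → i ≡ suc i′ → length (rowAt T i) < length (rowAt T i′)) →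
                   Linked ColLess (snocRow T i x)
columns-snocRow⁺ []               zero          x _          _             _ = [-]
columns-snocRow⁺ []               (suc i)       x _          _             _ = []
columns-snocRow⁺ (r ∷ [])         zero          x _          _             _ = [-]
columns-snocRow⁺ (r ∷ r′ ∷ T)     zero          x (c ∷ cols) _             _ = ColLess-++ʳ r [ x ] r′ c ∷ cols
columns-snocRow⁺ (r ∷ [])         (suc zero)    x _          (r<x ∷ _)     longer =
  ColLess-snoc r [] x tt (longer refl) r<x ∷ [-]
columns-snocRow⁺ (r ∷ [])         (suc (suc i)) x _          _             _ = [-]
columns-snocRow⁺ (r ∷ r′ ∷ T)     (suc zero)    x (c ∷ cols) (r<x ∷ T<x)   longer =
  ColLess-snoc r r′ x c (longer refl) r<x ∷ columns-snocRow⁺ (r′ ∷ T) zero x cols T<x λ ()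
columns-snocRow⁺ (r ∷ r′ ∷ T)     (suc (suc i)) x (c ∷ cols) (_ ∷ T<x)     longer =
  c ∷ columns-snocRow⁺ (r′ ∷ T) (suc i) x cols T<x (longer ∘ cong suc)

columns-snocRow⁻ : ∀ T i x → Linked ColLess (snocRow T i x) → All (All (_≤ x)) T → Linked ColLess T
columns-snocRow⁻ []           i             x _          _                 = []
columns-snocRow⁻ (r ∷ [])     i             x _          _                 = [-]
columns-snocRow⁻ (r ∷ r′ ∷ T) zero          x (c ∷ cols) (_ ∷ r′≤x ∷ _)   = ColLess-snoc⁻ r x r′ c r′≤x ∷ cols
columns-snocRow⁻ (r ∷ r′ ∷ T) (suc zero)    x (c ∷ cols) (_ ∷ T≤x)       =
  ColLess-++⁻ʳ r r′ [ x ] c ∷ columns-snocRow⁻ (r′ ∷ T) zero x cols T≤x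
columns-snocRow⁻ (r ∷ r′ ∷ T) (suc (suc i)) x (c ∷ cols) (_ ∷ T≤x)       =
  c ∷ columns-snocRow⁻ (r′ ∷ T) (suc i) x cols T≤x

shape-snocRow⁺ : ∀ T la i x → All (1 ≤_) la → part la (suc i) < part la i →
                 map length T ≡ decAt la i → map length (snocRow T i x) ≡ la
shape-snocRow⁺ []       (suc zero ∷ [])     zero    x _                  _         refl = refl
shape-snocRow⁺ T        (suc zero ∷ b ∷ xs) zero    x (_ ∷ 1≤b ∷ _)     (s≤s b<1) _    =
  contradiction (≤-trans 1≤b b<1) (<-irrefl refl)
shape-snocRow⁺ (r ∷ T)  (suc (suc n) ∷ xs)  zero    x _                  _         eq   =
  cong₂ _∷_ (trans (length-snoc r x) (cong suc (LP.∷-injectiveˡ eq))) (LP.∷-injectiveʳ eq)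
shape-snocRow⁺ []       (a ∷ xs)            (suc i) x _                  _         eq
  with () ← trans eq (decAt-suc a xs i)
shape-snocRow⁺ (r ∷ T)  (a ∷ xs)            (suc i) x (_ ∷ positive)    longer    eq
  with r≡a , T≡ ← LP.∷-injective (trans eq (decAt-suc a xs i)) =
  cong₂ _∷_ r≡a (shape-snocRow⁺ T xs i x positive longer T≡)

shape-snocRow⁻ : ∀ T i x → NonemptyRows T → i ≤ length T →
                 map length T ≡ decAt (map length (snocRow T i x)) i
shape-snocRow⁻ []            zero    x _              _ = refl
shape-snocRow⁻ ((a ∷ r) ∷ T) zero    x _              _ rewrite length-snoc r x = refl
shape-snocRow⁻ (r ∷ T)       (suc i) x (_ ∷ nonempty) (s≤s i≤len)
  rewrite decAt-suc (length r) (map length (snocRow T i x)) i =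
  cong (length r ∷_) (shape-snocRow⁻ T i x nonempty i≤len)

part-snocRow : ∀ {T la} i x → map length (snocRow T i x) ≡ la → i ≤ length T →
               part la i ≡ suc (length (rowAt T i))
part-snocRow {T} {la} i x shape i≤len = begin
  part la i                               ≡⟨ rowLength shape i ⟨
  length (rowAt (snocRow T i x) i)       ≡⟨ cong length (rowAt-snocRow-same T i x i≤len) ⟩
  length (rowAt T i ++ [ x ])            ≡⟨ length-snoc (rowAt T i) x ⟩
  suc (length (rowAt T i))               ∎
  where open ≡-Reasoning

sum-snocRow : ∀ {T la} i x → map length (snocRow T i x) ≡ la → i ≤ length T → suc (sum (decAt la i)) ≡ sum la
sum-snocRow {la = la} i x shape i≤len =
  sum-decAt la i (subst (1 ≤_) (sym (part-snocRow i x shape i≤len)) (s≤s z≤n))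

snocRow-longer : ∀ {T la} i x → map length (snocRow T i x) ≡ la → Linked ColLess (snocRow T i x) →
                 All (All (_≤ x)) T → i ≤ length T → part la (suc i) < part la i
snocRow-longer {T} {la} i x shape cols T≤x i≤len = begin-strict
  part la (suc i)                         ≡⟨ rowLength shape (suc i) ⟨
  length (rowAt (snocRow T i x) (suc i)) ≡⟨ cong length (rowAt-snocRow-below T i x) ⟩
  length (rowAt T (suc i))               ≤⟨ ColLess⇒length≥ (rowAt T i) _ rowsAdjacent ⟩
  length (rowAt T i)                     <⟨ n<1+n _ ⟩
  suc (length (rowAt T i))               ≡⟨ part-snocRow i x shape i≤len ⟨
  part la i                              ∎
  where
  open ≤-Reasoning
  rowsAdjacent : ColLess (rowAt T i) (rowAt T (suc i))
  rowsAdjacent = ColLess-snoc⁻ (rowAt T i) x _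
    (subst₂ ColLess (rowAt-snocRow-same T i x i≤len) (rowAt-snocRow-below T i x) (ColLess-rowAt cols i))
    (All-rowAt T (suc i) T≤x)

lastEntry : ∀ r x → Linked _<_ r → All (_≤ x) r → x ∈ r → ∃ λ r′ → r ≡ r′ ++ [ x ]
lastEntry (a ∷ [])    x _           _            (here refl) = [] , refl
lastEntry (a ∷ b ∷ r) x (a<b ∷ _)   (_ ∷ b≤a ∷ _) (here refl) = contradiction (<-≤-trans a<b b≤a) (<-irrefl refl)
lastEntry (a ∷ b ∷ r) x (_ ∷ linked) (_ ∷ r≤x)    (there x∈) =
  let r′ , eq = lastEntry (b ∷ r) x linked r≤x x∈ in a ∷ r′ , cong (a ∷_) eq

-- A row holding only the maximal entry is the last one: a row below would start with a larger entry.
maxEntry-snocRow : ∀ T x → x ∈ concat T → All (All (_≤ x)) T → All (Linked _<_) T → NonemptyRows T →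
                   Linked ColLess T → ∃₂ λ T′ i → T ≡ snocRow T′ i x × i ≤ length T′ × NonemptyRows T′
maxEntry-snocRow (r ∷ T) x x∈ (r≤x ∷ T≤x) (lr ∷ rows) (r-nonempty ∷ nonempty) cols with ∈-++⁻ r x∈
... | inj₂ x∈T =
  let T′ , i , eq , i≤len , nonempty′ = maxEntry-snocRow T x x∈T T≤x rows nonempty (Linked.tail cols)
  in r ∷ T′ , suc i , cong (r ∷_) eq , s≤s i≤len , r-nonempty ∷ nonempty′
... | inj₁ x∈r with lastEntry r x lr r≤x x∈r
...   | a ∷ r′ , refl = (a ∷ r′) ∷ T , zero , refl , z≤n , s≤s z≤n ∷ nonempty
...   | [] , refl with T | T≤x | nonempty | cols
...     | []           | _               | _          | _             = [] , zero , refl , z≤n , []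
...     | (b ∷ _) ∷ _  | (b≤x ∷ _) ∷ _   | _          | (x<b , _) ∷ _ = contradiction (<-≤-trans x<b b≤x) (<-irrefl refl)
...     | [] ∷ _       | _               | () ∷ _     | _

-- Adding and removing the largest entry

-- The bound n is decoupled from the shape μ, so that adding the entry n + 1 needs no arithmetic on sums.
IsTableau : List ℕ → ℕ → Filling → Set
IsTableau μ n T = (map length T ≡ μ) × EntriesOneTo n (concat T) × All (Linked _<_) T × Linked ColLess T

IsSYT⇒IsTableau : ∀ {μ T} → IsSYT μ T → IsTableau μ (sum μ) T
IsSYT⇒IsTableau (shape , bounded , once , rows , cols) = shape , (bounded , once) , rows , cols

IsTableau⇒IsSYT : ∀ {μ T} → IsTableau μ (sum μ) T → IsSYT μ T
IsTableau⇒IsSYT (shape , (bounded , once) , rows , cols) = shape , bounded , once , rows , cols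

longer⇒≤length : ∀ {la i} {T : Filling} → part la (suc i) < part la i →
                 map length T ≡ decAt la i → i ≤ length T
longer⇒≤length {la} {i} {T} longer shape =
  subst (i ≤_) (trans (cong length (sym shape)) (LP.length-map length T))
    (length-decAt la i (part>0⇒<length la i (≤-trans (s≤s z≤n) longer)))

tableau-snocRow⁺ : ∀ {la i m T} → IsPartition la → part la (suc i) < part la i →
                   IsTableau (decAt la i) m T → IsTableau la (suc m) (snocRow T i (suc m))
tableau-snocRow⁺ {la} {i} {m} {T} (decreasing , positive) longer (shape , entries , rows , cols) =
  shape-snocRow⁺ T la i (suc m) positive longer shape ,
  EntriesOneTo-resp-↭ (↭-sym (snocRow-↭ T i (suc m) i≤len)) (entriesOneTo-∷⁺ entries) ,
  rows-snocRow⁺ T i (suc m) rows (All-rowAt T i T<1+m) ,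
  columns-snocRow⁺ T i (suc m) cols T<1+m aboveLonger
  where
  T<1+m : All (All (_< suc m)) T
  T<1+m = AllP.concat⁻ (All.map s≤s (entriesOneTo-≤ entries))
  i≤len : i ≤ length T
  i≤len = longer⇒≤length {la} longer shape
  aboveLonger : ∀ {i′} → i ≡ suc i′ → length (rowAt T i) < length (rowAt T i′)
  aboveLonger {i′} refl = begin-strict
    length (rowAt T (suc i′))  ≡⟨ rowLength shape (suc i′) ⟩
    part (decAt la i) i        ≡⟨ part-decAt-same la i longer ⟩
    part la i ∸ 1              <⟨ ∸-monoˡ-< (s≤s (part-antitone decreasing i′)) (≤-trans (s≤s z≤n) longer) ⟩
    part la i′                 ≡⟨ part-decAt-above la i′ ⟨
    part (decAt la i) i′       ≡⟨ rowLength shape i′ ⟨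
    length (rowAt T i′)        ∎
    where open ≤-Reasoning

tableau-snocRow⁻ : ∀ {la i m T} → NonemptyRows T → i ≤ length T →
                   IsTableau la (suc m) (snocRow T i (suc m)) →
                   part la (suc i) < part la i × IsTableau (decAt la i) m T
tableau-snocRow⁻ {la} {i} {m} {T} nonempty i≤len (shape , entries , rows , cols) =
  snocRow-longer i (suc m) shape cols T≤1+m i≤len ,
  (trans (shape-snocRow⁻ T i (suc m) nonempty i≤len) (cong (λ μ → decAt μ i) shape) ,
   entriesT ,
   rows-snocRow⁻ T i (suc m) rows ,
   columns-snocRow⁻ T i (suc m) cols T≤1+m)
  where
  entriesT : EntriesOneTo m (concat T)
  entriesT = entriesOneTo-∷⁻ (EntriesOneTo-resp-↭ (snocRow-↭ T i (suc m) i≤len) entries)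
  T≤1+m : All (All (_≤ suc m)) T
  T≤1+m = AllP.concat⁻ (All.map m≤n⇒m≤1+n (entriesOneTo-≤ entriesT))

rowOf-snocRow-entries : ∀ {m} T i → EntriesOneTo m (concat T) → ∀ {y} → 1 ≤ y → y ≤ m →
                        rowOf (snocRow T i (suc m)) y ≡ rowOf T y
rowOf-snocRow-entries T i entries 1≤y y≤m =
  rowOf-snocRow-other T i _ (<⇒≢ (s≤s y≤m)) (entriesOneTo-∈ entries 1≤y y≤m)

-- IsSYTₕₐ μ h α T unfolds to IsSYT μ T × RowsIncrease h α T.
RowsIncrease : ℕ → ℕ → Filling → Set
RowsIncrease h α T = All (λ i → rowOf T (i + α) < rowOf T (suc i + α)) (range 1 h)

RowsIncrease-cong : ∀ {h α m} T T′ → h + α ≤ m → (∀ {y} → 1 ≤ y → y ≤ m → rowOf T y ≡ rowOf T′ y) →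
                    RowsIncrease h α T → RowsIncrease h α T′
RowsIncrease-cong {h} {α} T T′ h+α≤m sameRow increase = All-range⁺ λ {i} 1≤i i<h →
  subst₂ _<_ (sameRow (≤-trans 1≤i (m≤m+n i α)) (≤-trans (<⇒≤ (+-monoˡ-< α i<h)) h+α≤m))
             (sameRow (s≤s z≤n) (≤-trans (+-monoˡ-≤ α i<h) h+α≤m))
             (All-range⁻ increase 1≤i i<h)

module _ {h α : ℕ} where

  SYTₕₐ-snocRow⁺ : ∀ {la i T} → IsPartition la → part la (suc i) < part la i → h + α < sum la →
                   IsSYTₕₐ (decAt la i) h α T → IsSYTₕₐ la h α (snocRow T i (sum la))
  SYTₕₐ-snocRow⁺ {la} {i} {T} partition longer h+α<k (syt , increase) =
    let tableau , increase′ = subst (λ k → IsTableau la k (snocRow T i k) × RowsIncrease h α (snocRow T i k))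
                                    1+m≡k (tableau⁺ , increase⁺)
    in IsTableau⇒IsSYT tableau , increase′
    where
    m : ℕ
    m = sum (decAt la i)
    1+m≡k : suc m ≡ sum la
    1+m≡k = sum-decAt la i (≤-trans (s≤s z≤n) longer)
    tableau⁺ : IsTableau la (suc m) (snocRow T i (suc m))
    tableau⁺ = tableau-snocRow⁺ partition longer (IsSYT⇒IsTableau syt)
    increase⁺ : RowsIncrease h α (snocRow T i (suc m))
    increase⁺ = RowsIncrease-cong T (snocRow T i (suc m)) (s≤s⁻¹ (subst (h + α <_) (sym 1+m≡k) h+α<k))
      (λ 1≤y y≤m → sym (rowOf-snocRow-entries T i (proj₁ (proj₂ (IsSYT⇒IsTableau syt))) 1≤y y≤m)) increase

  SYTₕₐ-snocRow⁻ : ∀ {la i T} → NonemptyRows T → i ≤ length T → h + α < sum la →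
                   IsSYTₕₐ la h α (snocRow T i (sum la)) →
                   part la (suc i) < part la i × IsSYTₕₐ (decAt la i) h α T
  SYTₕₐ-snocRow⁻ {la} {i} {T} nonempty i≤len h+α<k (syt , increase)
    with 1+m≡k ← sum-snocRow i (sum la) (proj₁ syt) i≤len
    with tableau , increase′ ← subst (λ k → IsTableau la k (snocRow T i k) × RowsIncrease h α (snocRow T i k))
                                      (sym 1+m≡k) (IsSYT⇒IsTableau syt , increase)
    with longer , tableau⁻ ← tableau-snocRow⁻ nonempty i≤len tableau =
    longer , IsTableau⇒IsSYT tableau⁻ ,
    RowsIncrease-cong (snocRow T i _) T (s≤s⁻¹ (subst (h + α <_) (sym 1+m≡k) h+α<k))
      (rowOf-snocRow-entries T i (proj₁ (proj₂ tableau⁻))) increase′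

module Counting (h α : ℕ) where

  SYTs : List ℕ → List Filling
  SYTs μ = filter (isSYTₕₐ? μ h α) (fillings μ (range 1 (suc (sum μ))))

  ∈-SYTs⁻ : ∀ μ {T} → T ∈ SYTs μ → IsSYTₕₐ μ h α T
  ∈-SYTs⁻ μ T∈ = proj₂ (∈-filter⁻ (isSYTₕₐ? μ h α) {xs = fillings μ _} T∈)

  ∈-SYTs⁺ : ∀ {μ T} → IsSYTₕₐ μ h α T → T ∈ SYTs μ
  ∈-SYTs⁺ {μ} {T} syt@((shape , bounded , _) , _) =
    ∈-filter⁺ (isSYTₕₐ? μ h α) (∈-fillings⁺ μ _ T shape (AllP.concat⁻ (All.map inRange bounded))) syt
    where
    inRange : ∀ {x} → 1 ≤ x × x ≤ sum μ → x ∈ range 1 (suc (sum μ))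
    inRange (1≤x , x≤k) = ∈-range⁺ 1≤x (s≤s x≤k)

  unique-SYTs : ∀ μ → Unique (SYTs μ)
  unique-SYTs μ = Unique.filter⁺ (isSYTₕₐ? μ h α) (unique-fillings μ (unique-range 1 (suc (sum μ))))

  length-∈SYTs : ∀ μ {T} → T ∈ SYTs μ → length T ≡ length μ
  length-∈SYTs μ {T} T∈ = trans (sym (LP.length-map length T)) (cong length (proj₁ (proj₁ (∈-SYTs⁻ μ T∈))))

  extensions : List ℕ → Box → List Filling
  extensions la (i , _) = map (λ T → snocRow T i (sum la)) (SYTs (decAt la i))

  module _ {la} (partition : IsPartition la) (h+α<k : h + α < sum la) where

    extensions⊆SYTs : ∀ {T} → T ∈ concatMap (extensions la) (IC la) → T ∈ SYTs la
    extensions⊆SYTs T∈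
      with (i , j) , v∈ , T∈v ← find (∈-concatMap⁻ (extensions la) {xs = IC la} T∈)
      with T′ , T′∈ , refl ← ∈-map⁻ _ T∈v =
      ∈-SYTs⁺ (SYTₕₐ-snocRow⁺ partition (innerCorner⇒longer la (∈-IC⁻ la v∈)) h+α<k
                                (∈-SYTs⁻ (decAt la i) T′∈))

    SYTs⊆extensions : ∀ {T} → T ∈ SYTs la → T ∈ concatMap (extensions la) (IC la)
    SYTs⊆extensions {T} T∈
      with syt ← ∈-SYTs⁻ la T∈
      with shape , entries , rows , cols ← IsSYT⇒IsTableau (proj₁ syt)
      with T′ , i , refl , i≤len , nonempty ←
             maxEntry-snocRow T (sum la) (entriesOneTo-∈ entries (≤-trans (s≤s z≤n) h+α<k) ≤-refl)
               (AllP.concat⁻ (entriesOneTo-≤ entries)) rows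
               (AllP.map⁻ (subst (All (1 ≤_)) (sym shape) (proj₂ partition))) cols
      with longer , syt′ ← SYTₕₐ-snocRow⁻ nonempty i≤len h+α<k syt =
      ∈-concatMap⁺ (extensions la)
        (lose (∈-IC⁺ la (longer⇒innerCorner la longer)) (∈-map⁺ _ (∈-SYTs⁺ syt′)))

    rowOf-max-extension : ∀ {i j T} → InnerCorner la (i , j) → T ∈ SYTs (decAt la i) →
                          rowOf (snocRow T i (sum la)) (sum la) ≡ i
    rowOf-max-extension {i} {j} {T} corner T∈ =
      rowOf-snocRow-self T i (sum la) (max∉ (All.map (λ (_ , x≤m) → subst (_ <_) 1+m≡k (s≤s x≤m)) bounded))
        (longer⇒≤length {la} longer shape)
      where
      longer = innerCorner⇒longer la corner
      1+m≡k = sum-decAt la i (≤-trans (s≤s z≤n) longer)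
      shape = proj₁ (proj₁ (∈-SYTs⁻ (decAt la i) T∈))
      bounded = proj₁ (proj₂ (proj₁ (∈-SYTs⁻ (decAt la i) T∈)))

    extensions-disjoint : ∀ {v w T} → v ∈ IC la → w ∈ IC la →
                          T ∈ extensions la v → T ∈ extensions la w → v ≡ w
    extensions-disjoint {i , j} {i′ , j′} v∈ w∈ T∈ T∈′
      with ∈-map⁻ _ T∈ | ∈-map⁻ _ T∈′
    ... | T , T∈S , refl | T′ , T′∈S , eq
      with refl ← trans (sym (rowOf-max-extension (∈-IC⁻ la v∈) T∈S))
                        (trans (cong (λ U → rowOf U (sum la)) eq) (rowOf-max-extension (∈-IC⁻ la w∈) T′∈S)) =
      cong (i ,_) (suc-injective (trans (innerCorner⇒lastColumn la (∈-IC⁻ la v∈))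
                                        (sym (innerCorner⇒lastColumn la (∈-IC⁻ la w∈)))))

    unique-extensions : Unique (concatMap (extensions la) (IC la))
    unique-extensions = unique-concatMap⁺ (extensions la) (unique-IC la) unique-block extensions-disjoint
      where
      unique-block : ∀ {v} → v ∈ IC la → Unique (extensions la v)
      unique-block {i , j} _ = unique-map⁺ _ (λ T∈ T′∈ → snocRow-injective _ _ i _ (sameLength T∈ T′∈))
                                 (unique-SYTs (decAt la i))
        where
        sameLength : ∀ {T T′} → T ∈ SYTs (decAt la i) → T′ ∈ SYTs (decAt la i) → length T ≡ length T′
        sameLength T∈ T′∈ = trans (length-∈SYTs (decAt la i) T∈) (sym (length-∈SYTs (decAt la i) T′∈))

    length-SYTs : length (SYTs la) ≡ sum (map (λ v → length (SYTs (la -box v))) (IC la))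
    length-SYTs = begin
      length (SYTs la)
        ≡⟨ unique∧sameElements⇒length≡ (unique-SYTs la) unique-extensions SYTs⊆extensions extensions⊆SYTs ⟩
      length (concatMap (extensions la) (IC la))
        ≡⟨ length-concatMap (extensions la) (IC la) ⟩
      sum (map (length ∘ extensions la) (IC la))
        ≡⟨ cong sum (LP.map-cong (λ (i , _) → LP.length-map _ (SYTs (decAt la i))) (IC la)) ⟩
      sum (map (λ v → length (SYTs (la -box v))) (IC la))
        ∎
      where open ≡-Reasoning

lemma3p6 : (la : List ℕ) (k h α : ℕ) → la ⊢ k → h ≤ length la → α < k ∸ h →
    f la h α ≡ sum (map (λ v → f (la -box v) h α) (IC la))
lemma3p6 la _ h α (partition , refl) _ α<k∸h = Counting.length-SYTs h α partition (m<n∸o⇒o+m<n α<k∸h)
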